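{- Let $n\ge 2$ and let $M=\{m_1<\dots<m_t\}\subseteq[0,n-1]$ with $0\in M$. Let $B(M)=\{\beta\in B_n \mid \operatorname{Des}_B(\beta^{ -1})\subseteq M\}$ and $D(M)=\{\gamma\in D_n \mid \operatorname{Des}_D(\gamma^{ -1})\subseteq M\}$. Then: (i) $B(M)$ is the disjoint union $B(M)=D(M)\uplus \bar D(M)$, where $\bar D(M):=\{[-\gamma(1),\gamma(2),\dots,\gamma(n)] \mid \gamma\in D(M)\}=\{\gamma\cdot s_0^B \mid \gamma\in D(M)\}$; (ii) $\displaystyle\sum_{\beta\in B(M)} q^{\ell_D(\beta)} = 2\sum_{\gamma\in D(M)} q^{\ell_D(\gamma)}$.
   Context: $B_n$ is the group of bijections $\beta$ of $[-n,n]\setminus\{0\}$ with $\beta(-i)=-\beta(i)$, composed as functions ($(\beta\gamma)(i)=\beta(\gamma(i))$), written in window notation $[\beta(1),\dots,\beta(n)]$. $s_0^B=[-1,2,\dots,n]$. $D_n\subseteq B_n$ is the subgroup of signed permutations with an even number of negative entries among $\beta(1),\dots,\beta(n)$. For $\beta\in B_n$: $\operatorname{Des}_B(\beta)=\{i\in[0,n-1] \mid \beta(i)>\beta(i+1)\}$ with $\beta(0):=0$. For $\gamma\in D_n$: $\operatorname{Des}_D(\gamma)=\{i\in[0,n-1]\mid \gamma(i)>\gamma(i+1)\}$ with $\gamma(0):=-\gamma(2)$. For $\beta\in B_n$: $\operatorname{inv}(\beta)=|\{(i,j): 1\le i<j\le n,\ \beta(i)>\beta(j)\}|$, $\operatorname{N}_2(\beta)=|\{\{i,j\}\subseteq[n],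 i\neq j : \beta(i)+\beta(j)<0\}|$, and $\ell_D(\beta):=\operatorname{inv}(\beta)+\operatorname{N}_2(\beta)$ (which on $D_n$ is the Coxeter length of type $D$). -}

module Defs where

open import Level using (Level)
import Data.Bool
open import Data.Bool using (Bool; true; false; _∧_; _∨_; not; if_then_else_; T)
open import Data.Nat as ℕ using (ℕ; zero; suc; _≡ᵇ_; _%_)
open import Data.Integer as ℤ using (ℤ; +_; -[1+_]; -_; ∣_∣)
open import Data.Fin using (Fin; toℕ)
open import Data.Vec as Vec using (Vec; []; _∷_; tabulate; toList)
open import Data.List as List using (List; []; _∷_; _++_; map; upTo; concatMap; filter; foldr; length)
open import Data.Bool.ListAction using (and; or)
open import Data.Product using (Σ; _×_; _,_)
open import Relation.Nullary.Decidable using (⌊_⌋)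
open import Relation.Binary.PropositionalEquality using (_≡_)
open import Algebra.Bundles using (CommutativeSemiring)

-- Signed permutations of [-n,n]\{0} are represented by their window
-- [β(1),…,β(n)] : Vec ℤ n.  Arbitrary vectors are allowed as "candidates";
-- isSignedPerm singles out the genuine elements of B_n.

_<ᶻ_ : ℤ → ℤ → Bool
a <ᶻ b = ⌊ a ℤ.<? b ⌋

_>ᶻ_ : ℤ → ℤ → Bool
a >ᶻ b = b <ᶻ a

_==ᶻ_ : ℤ → ℤ → Bool
a ==ᶻ b = ⌊ a ℤ.≟ b ⌋

-- 0-based lookup of a list position (default 0 when out of range)
lookupℕ : List ℤ → ℕ → ℤ
lookupℕ []       _       = + 0
lookupℕ (x ∷ xs) zero    = x
lookupℕ (x ∷ xs) (suc m) = lookupℕ xs m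

-- β(i) for i ∈ ℤ, extended oddly: β(-i) = -β(i), β(0) = 0
ev : ∀ {n} → Vec ℤ n → ℤ → ℤ
ev β (+ zero)    = + 0
ev β (+ (suc m)) = lookupℕ (toList β) m
ev β -[1+ m ]    = - lookupℕ (toList β) m

pos : ℕ → List ℕ
pos n = map suc (upTo n)

distinctℕ : List ℕ → Bool
distinctℕ []       = true
distinctℕ (x ∷ xs) = and (map (λ y → not (x ≡ᵇ y)) xs) ∧ distinctℕ xs

isSignedPerm : ∀ {n} → Vec ℤ n → Bool
isSignedPerm {n} β =
  and (map (λ x → not (∣ x ∣ ≡ᵇ 0) ∧ (∣ x ∣ ℕ.≤ᵇ n)) (toList β))
  ∧ distinctℕ (map ∣_∣ (toList β))

isEvenSigned : ∀ {n} → Vec ℤ n → Bool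
isEvenSigned β = (length (filter (λ x → x ℤ.<? + 0) (toList β)) % 2) ≡ᵇ 0

preimage : List ℤ → ℕ → ℤ → ℤ
preimage []       j i = + 0
preimage (x ∷ xs) j i =
  if x ==ᶻ i then + j else (if x ==ᶻ (- i) then - (+ j) else preimage xs (suc j) i)

inverse : ∀ {n} → Vec ℤ n → Vec ℤ n
inverse β = tabulate (λ i → preimage (toList β) 1 (+ suc (toℕ i)))

compose : ∀ {n} → Vec ℤ n → Vec ℤ n → Vec ℤ n
compose β γ = tabulate (λ i → ev β (ev γ (+ suc (toℕ i))))

s0B : ∀ n → Vec ℤ n
s0B n = tabulate (λ i → f (toℕ i))
  where
  f : ℕ → ℤ
  f zero    = -[1+ 0 ]
  f (suc k) = + suc (suc k)

negFirst : ∀ {n} → Vec ℤ n → Vec ℤ n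
negFirst []       = []
negFirst (x ∷ xs) = (- x) ∷ xs

memb : List ℕ → ℕ → Bool
memb M i = or (map (λ m → m ≡ᵇ i) M)

-- Des_B(β) ⊆ M, with Des_B(β) = {i ∈ [0,n-1] | β(i) > β(i+1)}, β(0) := 0
desBSubset : ∀ {n} → List ℕ → Vec ℤ n → Bool
desBSubset {n} M β =
  and (map (λ i → not (ev β (+ i) >ᶻ ev β (+ suc i)) ∨ memb M i) (upTo n))

-- Des_D(γ) ⊆ M, with γ(0) := -γ(2)
evD : ∀ {n} → Vec ℤ n → ℕ → ℤ
evD γ zero    = - ev γ (+ 2)
evD γ (suc i) = ev γ (+ suc i)

desDSubset : ∀ {n} → List ℕ → Vec ℤ n → Bool
desDSubset {n} M γ =
  and (map (λ i → not (evD γ i >ᶻ evD γ (suc i)) ∨ memb M i) (upTo n))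

inBM : ∀ {n} → List ℕ → Vec ℤ n → Bool
inBM M β = isSignedPerm β ∧ desBSubset M (inverse β)

inDM : ∀ {n} → List ℕ → Vec ℤ n → Bool
inDM M γ = isSignedPerm γ ∧ isEvenSigned γ ∧ desDSubset M (inverse γ)

InDbar : ∀ {n} → List ℕ → Vec ℤ n → Set
InDbar {n} M β = Σ (Vec ℤ n) (λ γ → T (inDM M γ) × (β ≡ negFirst γ))

count : List Bool → ℕ
count []           = 0
count (true ∷ bs)  = suc (count bs)
count (false ∷ bs) = count bs

pairs : ℕ → List (ℕ × ℕ)
pairs n = concatMap (λ i → concatMap (λ j → if i ℕ.<ᵇ j then (i , j) ∷ [] else []) (pos n)) (pos n)

invB : ∀ {n} → Vec ℤ n → ℕ
invB {n} β = count (map (λ { (i , j) → ev β (+ i) >ᶻ ev β (+ j) }) (pairs n))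

-- N₂(β) = #{ {i,j} ⊆ [n], i ≠ j : β(i) + β(j) < 0 }  (unordered pairs, so i < j)
N2 : ∀ {n} → Vec ℤ n → ℕ
N2 {n} β = count (map (λ { (i , j) → (ev β (+ i) ℤ.+ ev β (+ j)) <ᶻ (+ 0) }) (pairs n))

ℓD : ∀ {n} → Vec ℤ n → ℕ
ℓD β = invB β ℕ.+ N2 β

-- Finite enumeration of candidate windows: all vectors of length n with
-- entries in [-n,n] (each exactly once).  B_n and D_n are subsets of this.

range : ℕ → List ℤ
range n = map +_ (upTo (suc n)) ++ map -[1+_] (upTo n)

vecsOver : List ℤ → (m : ℕ) → List (Vec ℤ m)
vecsOver R zero    = [] ∷ []
vecsOver R (suc m) = concatMap (λ x → map (x ∷_) (vecsOver R m)) R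

candidates : ∀ n → List (Vec ℤ n)
candidates n = vecsOver (range n) n

module _ {c ℓ : Level} (R : CommutativeSemiring c ℓ) where
  open CommutativeSemiring R

  pow : Carrier → ℕ → Carrier
  pow q zero    = 1#
  pow q (suc k) = q * pow q k

  genFun : ∀ n → (Vec ℤ n → Bool) → Carrier → Carrier
  genFun n P q = foldr (λ β acc → pow q (ℓD β) + acc) 0# (filter (λ β → P β Data.Bool.≟ true) (candidates n))

module Submission where

-- Everything rests on the involution β ↦ negFirst β = β s₀ of windows.  It preserves
-- being a signed permutation and ℓ_D = inv + N₂ (for a pair (1,j) the inversion test and
-- the negative-sum test are exchanged) and flips the parity of the number of negative
-- entries.  It also preserves Des_B(β⁻¹) ⊆ M: the inverse of β s₀ is s₀ β⁻¹, whose window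
-- differs from that of β⁻¹ by exchanging the values ±1; this changes no comparison of
-- consecutive entries except at position 0, and that descent is allowed as 0 ∈ M.  The
-- same reason makes the B- and D-descent conditions agree, so D(M) = B(M) ∩ D_n.
-- Part (i) follows by parity.  For (ii), the weighted indicator of B(M) is pointwise the
-- indicator of D(M) plus that of D(M) ∘ negFirst, and reindexing the sum over all
-- candidate windows by negFirst identifies the two sums.

open import Defs
open import Level using (Level)
open import Data.Nat as ℕ using (ℕ; zero; suc; z≤n; s≤s; _≤_; _<_; _≡ᵇ_; _%_)
import Data.Nat.Properties as ℕP
open import Data.Nat.Solver using (module +-*-Solver)
open import Data.Integer as ℤ using (ℤ; +_; -[1+_]; -_; ∣_∣)
import Data.Integer.Properties as ℤP
open import Data.Fin using (Fin; toℕ; fromℕ<) renaming (zero to fzero; suc to fsuc)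
open import Data.Fin.Properties using (toℕ-fromℕ<)
open import Data.Vec using (Vec; []; _∷_; tabulate; toList)
import Data.Vec.Properties as VecP
open import Data.List using (List; []; _∷_; _++_; map; upTo; applyUpTo; length; filter; concatMap)
import Data.List.Properties as ListP
open import Data.List.Relation.Unary.All using (All)
import Data.List.Relation.Unary.All.Properties as AllP
open import Data.List.Relation.Unary.AllPairs using (AllPairs)
open import Data.List.Relation.Unary.Any as Any using (here; there)
open import Data.List.Membership.Propositional using (_∈_; find)
open import Data.List.Membership.Propositional.Properties
  using (∈-map⁺; ∈-map⁻; ∈-filter⁺; ∈-upTo⁺; ∈-concatMap⁻)
open import Data.List.Membership.DecPropositional ℕ._≟_ using (_∈?_)
open import Data.Bool using (Bool; true; false; T; _∧_; _∨_; not; if_then_else_)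
import Data.Bool
import Data.Bool.Properties as BoolP
open import Data.Bool.ListAction using (and)
open import Data.Product using (_×_; _,_; proj₁; proj₂)
open import Data.Sum using (_⊎_; inj₁; inj₂; [_,_])
open import Data.Empty using (⊥; ⊥-elim)
open import Data.Unit using (⊤; tt)
open import Function.Base using (_∘_)
open import Function.Bundles using (_⇔_; mk⇔; Equivalence)
open import Relation.Nullary using (¬_; yes; no)
open import Relation.Nullary.Decidable using (¬?; isYes≗does; dec-true; dec-false; does-⇔)
open import Relation.Binary.PropositionalEquality
  using (_≡_; _≢_; refl; sym; trans; cong; cong₂; subst; subst₂; module ≡-Reasoning)
open import Algebra.Bundles using (CommutativeSemiring)

T-∧⁻ : ∀ a {b} → T (a ∧ b) → T a × T b
T-∧⁻ a = Equivalence.to (BoolP.T-∧ {a})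

T-∧⁺ : ∀ a {b} → T a → T b → T (a ∧ b)
T-∧⁺ a ta tb = Equivalence.from (BoolP.T-∧ {a}) (ta , tb)

T-and-map : ∀ {A : Set} (f : A → Bool) xs → T (and (map f xs)) → ∀ {y} → y ∈ xs → T (f y)
T-and-map f (x ∷ xs) t (here refl) = proj₁ (T-∧⁻ (f x) t)
T-and-map f (x ∷ xs) t (there m)   = T-and-map f xs (proj₂ (T-∧⁻ (f x) t)) m

T-not-¬ : ∀ {b} → T (not b) → ¬ T b
T-not-¬ {false} _ ()
T-not-¬ {true} ()

==ᶻ-true : ∀ {x y} → x ≡ y → (x ==ᶻ y) ≡ true
==ᶻ-true {x} {y} p = trans (isYes≗does (x ℤ.≟ y)) (dec-true (x ℤ.≟ y) p)

==ᶻ-false : ∀ {x y} → x ≢ y → (x ==ᶻ y) ≡ false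
==ᶻ-false {x} {y} p = trans (isYes≗does (x ℤ.≟ y)) (dec-false (x ℤ.≟ y) p)

<ᶻ-⇔ : ∀ {a b c d} → (a ℤ.< b ⇔ c ℤ.< d) → (a <ᶻ b) ≡ (c <ᶻ d)
<ᶻ-⇔ {a} {b} {c} {d} e =
  trans (isYes≗does (a ℤ.<? b)) (trans (does-⇔ e (a ℤ.<? b) (c ℤ.<? d)) (sym (isYes≗does (c ℤ.<? d))))

+-<-⇔ : ∀ c {a b} → a ℤ.< b ⇔ c ℤ.+ a ℤ.< c ℤ.+ b
+-<-⇔ c {a} {b} = mk⇔ (ℤP.+-monoʳ-< c) (λ h → subst₂ ℤ._<_ (cancel a) (cancel b) (ℤP.+-monoʳ-< (- c) h))
  where
  cancel : ∀ x → - c ℤ.+ (c ℤ.+ x) ≡ x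
  cancel x = trans (sym (ℤP.+-assoc (- c) c x)) (trans (cong (ℤ._+ x) (ℤP.+-inverseˡ c)) (ℤP.+-identityˡ x))

-- For a pair (1, j) with β(1) = x, β(j) = y: negating x turns the inversion test into the
-- negative-sum test and vice versa.
lt-neg≡sum-neg : ∀ x y → (y <ᶻ (- x)) ≡ ((x ℤ.+ y) <ᶻ (+ 0))
lt-neg≡sum-neg x y = <ᶻ-⇔ (subst (λ z → y ℤ.< - x ⇔ x ℤ.+ y ℤ.< z) (ℤP.+-inverseʳ x) (+-<-⇔ x))

lt≡diff-neg : ∀ x y → (y <ᶻ x) ≡ ((- x ℤ.+ y) <ᶻ (+ 0))
lt≡diff-neg x y = <ᶻ-⇔ (subst (λ z → y ℤ.< x ⇔ - x ℤ.+ y ℤ.< z) (ℤP.+-inverseˡ x) (+-<-⇔ (- x)))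

lookup-tabulate : ∀ {n} (h : Fin n → ℤ) (i : Fin n) → lookupℕ (toList (tabulate h)) (toℕ i) ≡ h i
lookup-tabulate h fzero    = refl
lookup-tabulate h (fsuc i) = lookup-tabulate (h ∘ fsuc) i

tabulate-lookup : ∀ {n} (xs : Vec ℤ n) → tabulate (λ i → lookupℕ (toList xs) (toℕ i)) ≡ xs
tabulate-lookup []       = refl
tabulate-lookup (x ∷ xs) = cong (x ∷_) (tabulate-lookup xs)

inverse-at : ∀ {n} (β : Vec ℤ n) {k} → k < n → ev (inverse β) (+ suc k) ≡ preimage (toList β) 1 (+ suc k)
inverse-at β {k} k<n =
  subst (λ j → lookupℕ (toList (inverse β)) j ≡ preimage (toList β) 1 (+ suc j))
        (toℕ-fromℕ< k<n) (lookup-tabulate _ (fromℕ< k<n))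

-- A duplicate-free list contained in S is no longer than S: its head can be removed from S.
distinct-length-≤ : ∀ xs S → T (distinctℕ xs) → (∀ {y} → y ∈ xs → y ∈ S) → length xs ≤ length S
distinct-length-≤ []       S _ _   = z≤n
distinct-length-≤ (x ∷ xs) S d sub =
  ℕP.≤-trans (s≤s (distinct-length-≤ xs S′ (proj₂ d′) sub′)) (ListP.filter-notAll ≢x? S x∈S)
  where
  ≢x? = λ y → ¬? (y ℕ.≟ x)
  S′  = filter ≢x? S
  d′  = T-∧⁻ (and (map (λ y → not (x ≡ᵇ y)) xs)) d
  x∈S = Any.map (λ e ne → ne (sym e)) (sub (here refl))
  sub′ : ∀ {y} → y ∈ xs → y ∈ S′
  sub′ {y} m = ∈-filter⁺ ≢x? (sub (there m))
    (λ { refl → T-not-¬ (T-and-map (λ y → not (x ≡ᵇ y)) xs (proj₁ d′) m) (ℕP.≡⇒≡ᵇ y y refl) })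

pos-∈ : ∀ {n v} → 1 ≤ v → v ≤ n → v ∈ pos n
pos-∈ {v = suc v} _ v≤n = ∈-map⁺ suc (∈-upTo⁺ v≤n)

distinct-covers : ∀ n (A : List ℕ) → length A ≡ n → T (distinctℕ A) →
                  (∀ {v} → v ∈ A → 1 ≤ v × v ≤ n) → ∀ {p} → 1 ≤ p → p ≤ n → p ∈ A
distinct-covers n A len d bounds {p} 1≤p p≤n with p ∈? A
... | yes p∈A = p∈A
... | no  p∉A = ⊥-elim (ℕP.<-irrefl refl (ℕP.≤-<-trans (subst (_≤ length S) len A≤S) S<n))
  where
  ≢p? = λ y → ¬? (y ℕ.≟ p)
  S   = filter ≢p? (pos n)
  A≤S : length A ≤ length S
  A≤S = distinct-length-≤ A S d λ m →
    ∈-filter⁺ ≢p? (pos-∈ (proj₁ (bounds m)) (proj₂ (bounds m))) (λ { refl → p∉A m })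
  S<n : length S < n
  S<n = subst (length S <_) (trans (ListP.length-map suc (upTo n)) (ListP.length-upTo n))
          (ListP.filter-notAll ≢p? (pos n) (Any.map (λ e ne → ne (sym e)) (pos-∈ 1≤p p≤n)))

signedPerm-covers : ∀ {n} (β : Vec ℤ n) → T (isSignedPerm β) → ∀ {k} → suc k ≤ n → suc k ∈ map ∣_∣ (toList β)
signedPerm-covers {n} β sp k<n =
  distinct-covers n (map ∣_∣ (toList β))
    (trans (ListP.length-map ∣_∣ (toList β)) (VecP.length-toList β))
    (proj₂ sp′) bounds (s≤s z≤n) k<n
  where
  inRange = λ x → not (∣ x ∣ ≡ᵇ 0) ∧ (∣ x ∣ ℕ.≤ᵇ n)
  sp′ = T-∧⁻ (and (map inRange (toList β))) sp
  bounds : ∀ {v} → v ∈ map ∣_∣ (toList β) → 1 ≤ v × v ≤ n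
  bounds m with ∈-map⁻ ∣_∣ m
  ... | x , x∈β , refl with ∣ x ∣ | T-and-map inRange (toList β) (proj₁ sp′) x∈β
  ...   | zero  | ()
  ...   | suc a | t = s≤s z≤n , ℕP.≤ᵇ⇒≤ (suc a) n (proj₂ (T-∧⁻ true t))

-- The permutation of ℤ exchanging 1 and -1.  Left multiplication by s₀ acts on a window
-- in this way, and (β s₀)⁻¹ = s₀ β⁻¹.
swap±1 : ℤ → ℤ
swap±1 (+ suc zero) = -[1+ 0 ]
swap±1 -[1+ zero ]  = + 1
swap±1 a            = a

IsUnit : ℤ → Set
IsUnit (+ suc zero) = ⊤
IsUnit -[1+ zero ]  = ⊤
IsUnit _            = ⊥

preimage-from-2-fixed : ∀ xs j i → swap±1 (preimage xs (suc (suc j)) i) ≡ preimage xs (suc (suc j)) i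
preimage-from-2-fixed []       j i = refl
preimage-from-2-fixed (x ∷ xs) j i with x ==ᶻ i
... | true  = refl
... | false with x ==ᶻ (- i)
...   | true  = refl
...   | false = preimage-from-2-fixed xs (suc j) i

preimage-from-2-nonunit : ∀ xs j i → ¬ IsUnit (preimage xs (suc (suc j)) i)
preimage-from-2-nonunit []       j i ()
preimage-from-2-nonunit (x ∷ xs) j i with x ==ᶻ i
... | true  = λ ()
... | false with x ==ᶻ (- i)
...   | true  = λ ()
...   | false = preimage-from-2-nonunit xs (suc j) i

negate-eq : ∀ {x y} → - x ≡ y → x ≡ - y
negate-eq {x} refl = sym (ℤP.neg-involutive x)

preimage-negHead : ∀ x xs k → preimage ((- x) ∷ xs) 1 (+ suc k) ≡ swap±1 (preimage (x ∷ xs) 1 (+ suc k))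
preimage-negHead x xs k with x ℤ.≟ (+ suc k)
... | yes refl rewrite ==ᶻ-true { -[1+ k ]} refl = refl
... | no x≢k with x ℤ.≟ -[1+ k ]
...   | yes refl rewrite ==ᶻ-true {+ suc k} refl = refl
...   | no x≢-k
  rewrite ==ᶻ-false { - x} {+ suc k}   (x≢-k ∘ negate-eq)
        | ==ᶻ-false { - x} { -[1+ k ]} (x≢k ∘ negate-eq)
  = sym (preimage-from-2-fixed xs 0 (+ suc k))

preimage-unit : ∀ x xs k → IsUnit (preimage (x ∷ xs) 1 (+ suc k)) → ∣ x ∣ ≡ suc k
preimage-unit x xs k u with x ℤ.≟ (+ suc k)
... | yes refl = refl
... | no _ with x ℤ.≟ -[1+ k ]
...   | yes refl = refl
...   | no _     = ⊥-elim (preimage-from-2-nonunit xs 0 (+ suc k) u)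

preimage-nonzero : ∀ L j k → suc k ∈ map ∣_∣ L → preimage L (suc j) (+ suc k) ≢ + 0
preimage-nonzero (y ∷ ys) j k mem with y ℤ.≟ (+ suc k)
... | yes refl = λ ()
... | no y≢k with y ℤ.≟ -[1+ k ]
...   | yes refl rewrite ==ᶻ-false y≢k = λ ()
...   | no y≢-k with mem
...     | there m = preimage-nonzero ys (suc j) k m
...     | here e with y
...       | + zero   = λ _ → ℕP.0≢1+n (sym e)
...       | + suc a  = ⊥-elim (y≢k (cong +_ (sym e)))
...       | -[1+ a ] = ⊥-elim (y≢-k (cong -[1+_] (ℕP.suc-injective (sym e))))

swap±1-<ᶻ : ∀ a b → a ≢ + 0 → b ≢ + 0 → (IsUnit a → IsUnit b → ⊥) → (swap±1 b <ᶻ swap±1 a) ≡ (b <ᶻ a)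
swap±1-<ᶻ (+ zero)         b                a≢0 _   _ = ⊥-elim (a≢0 refl)
swap±1-<ᶻ a                (+ zero)         _   b≢0 _ = ⊥-elim (b≢0 refl)
swap±1-<ᶻ (+ suc zero)     (+ suc zero)     _   _   u = ⊥-elim (u tt tt)
swap±1-<ᶻ (+ suc zero)     -[1+ zero ]      _   _   u = ⊥-elim (u tt tt)
swap±1-<ᶻ -[1+ zero ]      (+ suc zero)     _   _   u = ⊥-elim (u tt tt)
swap±1-<ᶻ -[1+ zero ]      -[1+ zero ]      _   _   u = ⊥-elim (u tt tt)
swap±1-<ᶻ (+ suc zero)     (+ suc (suc b))  _   _   _ = refl
swap±1-<ᶻ (+ suc zero)     -[1+ suc b ]     _   _   _ = refl
swap±1-<ᶻ (+ suc (suc a))  (+ suc zero)     _   _   _ = refl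
swap±1-<ᶻ (+ suc (suc a))  (+ suc (suc b))  _   _   _ = refl
swap±1-<ᶻ (+ suc (suc a))  -[1+ zero ]      _   _   _ = refl
swap±1-<ᶻ (+ suc (suc a))  -[1+ suc b ]     _   _   _ = refl
swap±1-<ᶻ -[1+ zero ]      (+ suc (suc b))  _   _   _ = refl
swap±1-<ᶻ -[1+ zero ]      -[1+ suc b ]     _   _   _ = refl
swap±1-<ᶻ -[1+ suc a ]     (+ suc zero)     _   _   _ = refl
swap±1-<ᶻ -[1+ suc a ]     (+ suc (suc b))  _   _   _ = refl
swap±1-<ᶻ -[1+ suc a ]     -[1+ zero ]      _   _   _ = refl
swap±1-<ᶻ -[1+ suc a ]     -[1+ suc b ]     _   _   _ = refl

-- "Des(f) ⊆ M" for a function f on positions 0,…,n; desBSubset and desDSubset are the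
-- instances f = ev δ and f = evD δ.
descentsIn : ℕ → List ℕ → (ℕ → ℤ) → Bool
descentsIn n M f = and (map (λ i → not (f i >ᶻ f (suc i)) ∨ memb M i) (upTo n))

memb-∈ : ∀ {M i} → i ∈ M → memb M i ≡ true
memb-∈ {i = i} (here refl) rewrite Equivalence.to BoolP.T-≡ (ℕP.≡⇒≡ᵇ i i refl) = refl
memb-∈ {m ∷ M} (there p) rewrite memb-∈ p = BoolP.∨-zeroʳ (m ≡ᵇ _)

-- When 0 ∈ M the descent at 0 is always allowed, so Des(f) ⊆ M only depends on the
-- comparisons at positions 1,…,n-1.
descentsIn-cong : ∀ n M (f h : ℕ → ℤ) → 0 ∈ M →
  (∀ {k} → suc k < n → (f (suc k) >ᶻ f (suc (suc k))) ≡ (h (suc k) >ᶻ h (suc (suc k)))) →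
  descentsIn n M f ≡ descentsIn n M h
descentsIn-cong zero    M f h _   _     = refl
descentsIn-cong (suc n) M f h 0∈M agree = cong₂ _∧_ atZero atPositive
  where
  atZero : (not (f 0 >ᶻ f 1) ∨ memb M 0) ≡ (not (h 0 >ᶻ h 1) ∨ memb M 0)
  atZero rewrite memb-∈ 0∈M = trans (BoolP.∨-zeroʳ _) (sym (BoolP.∨-zeroʳ _))
  atPositive : and (map (λ i → not (f i >ᶻ f (suc i)) ∨ memb M i) (applyUpTo suc n))
             ≡ and (map (λ i → not (h i >ᶻ h (suc i)) ∨ memb M i) (applyUpTo suc n))
  atPositive = cong and (ListP.map-cong-local (AllP.applyUpTo⁺₁ suc n
    (λ {k} k<n → cong (λ b → not b ∨ memb M (suc k)) (agree (s≤s k<n)))))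

-- For 0 ∈ M the type-B and type-D descent conditions coincide (they differ only at 0).
desB≡desD : ∀ {n} M (δ : Vec ℤ n) → 0 ∈ M → desBSubset M δ ≡ desDSubset M δ
desB≡desD {n} M δ 0∈M = descentsIn-cong n M (λ i → ev δ (+ i)) (evD δ) 0∈M (λ _ → refl)

-- For 0 ∈ M, negating β(1) of a signed permutation does not affect Des_B(β⁻¹) ⊆ M:
-- the inverse window changes by swap±1, which keeps the comparisons at positions ≥ 1.
desB-inverse-negFirst : ∀ {n} M (β : Vec ℤ (suc n)) → T (isSignedPerm β) → 0 ∈ M →
  desBSubset M (inverse (negFirst β)) ≡ desBSubset M (inverse β)
desB-inverse-negFirst {n} M β@(x ∷ xs) sp 0∈M =
  descentsIn-cong (suc n) M (λ i → ev ι′ (+ i)) (λ i → ev ι (+ i)) 0∈M agree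
  where
  ι  = inverse β
  ι′ = inverse (negFirst β)
  G : ℕ → ℤ
  G k = preimage (toList β) 1 (+ suc k)
  ι′-at : ∀ {k} → k < suc n → ev ι′ (+ suc k) ≡ swap±1 (G k)
  ι′-at k<n = trans (inverse-at (negFirst β) k<n) (preimage-negHead x (toList xs) _)
  G≢0 : ∀ {k} → k < suc n → G k ≢ + 0
  G≢0 k<n = preimage-nonzero (toList β) 0 _ (signedPerm-covers β sp k<n)
  agree : ∀ {k} → suc k < suc n → (ev ι′ (+ suc k) >ᶻ ev ι′ (+ suc (suc k))) ≡ (ev ι (+ suc k) >ᶻ ev ι (+ suc (suc k)))
  agree {k} (s≤s k+1<n) = begin
    ev ι′ (+ suc k) >ᶻ ev ι′ (+ suc (suc k))  ≡⟨ cong₂ _>ᶻ_ (ι′-at k<1+n) (ι′-at (s≤s k+1<n)) ⟩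
    swap±1 (G k) >ᶻ swap±1 (G (suc k))        ≡⟨ swap±1-<ᶻ (G k) (G (suc k)) (G≢0 k<1+n) (G≢0 (s≤s k+1<n)) notBothUnits ⟩
    G k >ᶻ G (suc k)                          ≡⟨ sym (cong₂ _>ᶻ_ (inverse-at β k<1+n) (inverse-at β (s≤s k+1<n))) ⟩
    ev ι (+ suc k) >ᶻ ev ι (+ suc (suc k))    ∎
    where
    open ≡-Reasoning
    k<1+n = ℕP.m<n⇒m<1+n k+1<n
    notBothUnits : IsUnit (G k) → IsUnit (G (suc k)) → ⊥
    notBothUnits u v = ℕP.1+n≢n (trans (sym (preimage-unit x (toList xs) (suc k) v)) (preimage-unit x (toList xs) k u))

negFirst-involutive : ∀ {n} (β : Vec ℤ (suc n)) → negFirst (negFirst β) ≡ β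
negFirst-involutive (x ∷ xs) = cong (_∷ xs) (ℤP.neg-involutive x)

-- Being a signed permutation only depends on the absolute values of the entries.
signedPerm-negFirst : ∀ {n} (β : Vec ℤ (suc n)) → isSignedPerm (negFirst β) ≡ isSignedPerm β
signedPerm-negFirst (x ∷ xs) rewrite ℤP.∣-i∣≡∣i∣ x = refl

even-suc : ∀ k → ((suc k % 2) ≡ᵇ 0) ≡ not ((k % 2) ≡ᵇ 0)
even-suc zero          = refl
even-suc (suc zero)    = refl
even-suc (suc (suc k)) = even-suc k

-- Negating the nonzero entry β(1) changes the number of negative entries by one.
parity-negFirst : ∀ {n} (β : Vec ℤ (suc n)) → T (isSignedPerm β) →
  isEvenSigned (negFirst β) ≡ not (isEvenSigned β)
parity-negFirst (+ zero   ∷ xs) ()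
parity-negFirst (+ suc _  ∷ xs) _ = even-suc (length (filter (ℤ._<? + 0) (toList xs)))
parity-negFirst (-[1+ _ ] ∷ xs) _ =
  trans (sym (BoolP.not-involutive _)) (cong not (sym (even-suc (length (filter (ℤ._<? + 0) (toList xs))))))

bit : Bool → ℕ
bit true  = 1
bit false = 0

count-∷ : ∀ b bs → count (b ∷ bs) ≡ bit b ℕ.+ count bs
count-∷ true  bs = refl
count-∷ false bs = refl

count-+-cong : ∀ {A : Set} (P : List A) (a b a′ b′ : A → Bool) →
  (∀ {p} → p ∈ P → bit (a p) ℕ.+ bit (b p) ≡ bit (a′ p) ℕ.+ bit (b′ p)) →
  count (map a P) ℕ.+ count (map b P) ≡ count (map a′ P) ℕ.+ count (map b′ P)
count-+-cong []      a b a′ b′ _     = refl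
count-+-cong (p ∷ P) a b a′ b′ agree = begin
  count (a p ∷ map a P) ℕ.+ count (b p ∷ map b P)
    ≡⟨ cong₂ ℕ._+_ (count-∷ (a p) _) (count-∷ (b p) _) ⟩
  (bit (a p) ℕ.+ count (map a P)) ℕ.+ (bit (b p) ℕ.+ count (map b P))
    ≡⟨ interchange (bit (a p)) _ _ _ ⟩
  (bit (a p) ℕ.+ bit (b p)) ℕ.+ (count (map a P) ℕ.+ count (map b P))
    ≡⟨ cong₂ ℕ._+_ (agree (here refl)) (count-+-cong P a b a′ b′ (agree ∘ there)) ⟩
  (bit (a′ p) ℕ.+ bit (b′ p)) ℕ.+ (count (map a′ P) ℕ.+ count (map b′ P))
    ≡⟨ sym (interchange (bit (a′ p)) _ _ _) ⟩
  (bit (a′ p) ℕ.+ count (map a′ P)) ℕ.+ (bit (b′ p) ℕ.+ count (map b′ P))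
    ≡⟨ sym (cong₂ ℕ._+_ (count-∷ (a′ p) _) (count-∷ (b′ p) _)) ⟩
  count (a′ p ∷ map a′ P) ℕ.+ count (b′ p ∷ map b′ P) ∎
  where
  open ≡-Reasoning
  open +-*-Solver
  interchange : ∀ w x y z → (w ℕ.+ x) ℕ.+ (y ℕ.+ z) ≡ (w ℕ.+ y) ℕ.+ (x ℕ.+ z)
  interchange = solve 4 (λ w x y z → (w :+ x) :+ (y :+ z) := (w :+ y) :+ (x :+ z)) refl

pairs-sound : ∀ {n i j} → (i , j) ∈ pairs n → 1 ≤ i × i < j
pairs-sound {n} m with find (∈-concatMap⁻ _ {xs = pos n} m)
... | i , i∈pos , m′ with find (∈-concatMap⁻ _ {xs = pos n} m′) | ∈-map⁻ suc i∈pos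
...   | j , _ , m″ | _ , _ , refl with i ℕ.<ᵇ j in i<ᵇj
...     | true  with m″
...       | here refl = s≤s z≤n , ℕP.<ᵇ⇒< i j (subst T (sym i<ᵇj) tt)
pairs-sound {n} m | _ , _ , _ | _ , _ , () | _ , _ , refl | false

-- ℓ_D = inv + N₂ is unchanged by negating β(1): for a pair (1, j) the inversion test
-- and the negative-sum test are exchanged, and pairs avoiding 1 are untouched.
ℓD-negFirst : ∀ {n} (β : Vec ℤ (suc n)) → ℓD (negFirst β) ≡ ℓD β
ℓD-negFirst {n} β@(x ∷ xs) = count-+-cong (pairs (suc n)) _ _ _ _ (λ m → pairContribution (pairs-sound {suc n} m))
  where
  β′ = negFirst β
  pairContribution : ∀ {i j} → 1 ≤ i × i < j →
    bit (ev β′ (+ i) >ᶻ ev β′ (+ j)) ℕ.+ bit ((ev β′ (+ i) ℤ.+ ev β′ (+ j)) <ᶻ (+ 0))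
    ≡ bit (ev β (+ i) >ᶻ ev β (+ j)) ℕ.+ bit ((ev β (+ i) ℤ.+ ev β (+ j)) <ᶻ (+ 0))
  pairContribution {suc zero}    {suc (suc j)} _ rewrite lt-neg≡sum-neg x (lookupℕ (toList xs) j)
                                                        | lt≡diff-neg x (lookupℕ (toList xs) j)
    = ℕP.+-comm (bit ((x ℤ.+ lookupℕ (toList xs) j) <ᶻ (+ 0))) _
  pairContribution {suc (suc i)} {suc (suc j)} _ = refl
  pairContribution {suc zero}    {suc zero}    (_ , s≤s ())
  pairContribution {suc (suc i)} {suc zero}    (_ , s≤s ())
  pairContribution {suc i}       {zero}        (_ , ())

s0B-fixes : ∀ n (j : Fin n) → ev (s0B (suc n)) (+ suc (suc (toℕ j))) ≡ + suc (suc (toℕ j))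
s0B-fixes n j = lookup-tabulate _ j

negFirst≡compose-s0B : ∀ {n} (γ : Vec ℤ (suc n)) → negFirst γ ≡ compose γ (s0B (suc n))
negFirst≡compose-s0B {n} (x ∷ xs) = cong ((- x) ∷_) (sym (trans (VecP.tabulate-cong onTail) (tabulate-lookup xs)))
  where
  onTail : ∀ j → ev (x ∷ xs) (ev (s0B (suc n)) (+ suc (toℕ (fsuc j)))) ≡ lookupℕ (toList xs) (toℕ j)
  onTail j = cong (ev (x ∷ xs)) (s0B-fixes n j)

inDM≡ : ∀ {n} M (β : Vec ℤ n) → 0 ∈ M → inDM M β ≡ inBM M β ∧ isEvenSigned β
inDM≡ M β 0∈M rewrite desB≡desD M (inverse β) 0∈M with isSignedPerm β
... | true  = BoolP.∧-comm (isEvenSigned β) _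
... | false = refl

inBM-negFirst : ∀ {n} M (β : Vec ℤ (suc n)) → 0 ∈ M → inBM M (negFirst β) ≡ inBM M β
inBM-negFirst M β 0∈M rewrite signedPerm-negFirst β with isSignedPerm β in sp
... | true  = desB-inverse-negFirst M β (subst T (sym sp) tt) 0∈M
... | false = refl

inDM-negFirst : ∀ {n} M (β : Vec ℤ (suc n)) → 0 ∈ M → T (inBM M β) →
  inDM M (negFirst β) ≡ not (isEvenSigned β)
inDM-negFirst M β 0∈M β∈B = begin
  inDM M (negFirst β)                          ≡⟨ inDM≡ M (negFirst β) 0∈M ⟩
  inBM M (negFirst β) ∧ isEvenSigned (negFirst β) ≡⟨ cong₂ _∧_ (inBM-negFirst M β 0∈M) (parity-negFirst β signedPerm) ⟩
  inBM M β ∧ not (isEvenSigned β)              ≡⟨ cong (_∧ not (isEvenSigned β)) (Equivalence.to BoolP.T-≡ β∈B) ⟩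
  not (isEvenSigned β)                         ∎
  where
  open ≡-Reasoning
  signedPerm = proj₁ (T-∧⁻ (isSignedPerm β) β∈B)

inDM⁻ : ∀ {n} M (γ : Vec ℤ n) → T (inDM M γ) → T (isSignedPerm γ) × T (isEvenSigned γ)
inDM⁻ M γ γ∈D with T-∧⁻ (isSignedPerm γ) γ∈D
... | sp , rest = sp , proj₁ (T-∧⁻ (isEvenSigned γ) rest)

D⊆B : ∀ {n} M (β : Vec ℤ n) → 0 ∈ M → T (inDM M β) → T (inBM M β)
D⊆B M β 0∈M β∈D = proj₁ (T-∧⁻ (inBM M β) (subst T (inDM≡ M β 0∈M) β∈D))

D̄⊆B : ∀ {n} M (β : Vec ℤ (suc n)) → 0 ∈ M → InDbar M β → T (inBM M β)
D̄⊆B M _ 0∈M (γ , γ∈D , refl) = subst T (sym (inBM-negFirst M γ 0∈M)) (D⊆B M γ 0∈M γ∈D)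

B⊆D∪D̄ : ∀ {n} M (β : Vec ℤ (suc n)) → 0 ∈ M → T (inBM M β) → T (inDM M β) ⊎ InDbar M β
B⊆D∪D̄ M β 0∈M β∈B = byParity (isEvenSigned β) refl
  where
  byParity : ∀ e → isEvenSigned β ≡ e → T (inDM M β) ⊎ InDbar M β
  byParity true  even = inj₁ (subst T (sym (inDM≡ M β 0∈M)) (T-∧⁺ (inBM M β) β∈B (subst T (sym even) tt)))
  byParity false odd  = inj₂ (negFirst β , negFirst-β∈D , sym (negFirst-involutive β))
    where
    negFirst-β∈D : T (inDM M (negFirst β))
    negFirst-β∈D = subst T (sym (trans (inDM-negFirst M β 0∈M β∈B) (cong not odd))) tt

D∩D̄-empty : ∀ {n} M (β : Vec ℤ (suc n)) → T (inDM M β) → InDbar M β → ⊥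
D∩D̄-empty M _ β∈D (γ , γ∈D , refl) with inDM⁻ M γ γ∈D
... | sp , γ-even = T-not-¬ (subst T (parity-negFirst γ sp) (proj₂ (inDM⁻ M (negFirst γ) β∈D))) γ-even

B⇔D⊎D̄ : ∀ {n} M (β : Vec ℤ (suc n)) → 0 ∈ M → T (inBM M β) ⇔ (T (inDM M β) ⊎ InDbar M β)
B⇔D⊎D̄ M β 0∈M = mk⇔ (B⊆D∪D̄ M β 0∈M) [ D⊆B M β 0∈M , D̄⊆B M β 0∈M ]

module WeightedSums {c ℓ : Level} (R : CommutativeSemiring c ℓ) (q : CommutativeSemiring.Carrier R) where
  open CommutativeSemiring R renaming (refl to ≈-refl; sym to ≈-sym; trans to ≈-trans)
  open import Relation.Binary.Reasoning.Setoid setoid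

  sumL : {A : Set} → (A → Carrier) → List A → Carrier
  sumL F []       = 0#
  sumL F (a ∷ as) = F a + sumL F as

  sumL-cong : {A : Set} {F G : A → Carrier} → (∀ a → F a ≈ G a) → ∀ l → sumL F l ≈ sumL G l
  sumL-cong F≈G []      = ≈-refl
  sumL-cong F≈G (a ∷ l) = +-cong (F≈G a) (sumL-cong F≈G l)

  sumL-+ : {A : Set} (F G : A → Carrier) → ∀ l → sumL (λ a → F a + G a) l ≈ sumL F l + sumL G l
  sumL-+ F G []      = ≈-sym (+-identityˡ 0#)
  sumL-+ F G (a ∷ l) = begin
    (F a + G a) + sumL (λ a → F a + G a) l ≈⟨ +-congˡ (sumL-+ F G l) ⟩
    (F a + G a) + (sumL F l + sumL G l)     ≈⟨ interchange ⟩
    (F a + sumL F l) + (G a + sumL G l)     ∎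
    where
    interchange : ∀ {w x y z} → (w + x) + (y + z) ≈ (w + y) + (x + z)
    interchange {w} {x} {y} {z} = begin
      (w + x) + (y + z) ≈⟨ +-assoc w x (y + z) ⟩
      w + (x + (y + z)) ≈⟨ +-congˡ (≈-sym (+-assoc x y z)) ⟩
      w + ((x + y) + z) ≈⟨ +-congˡ (+-congʳ (+-comm x y)) ⟩
      w + ((y + x) + z) ≈⟨ +-congˡ (+-assoc y x z) ⟩
      w + (y + (x + z)) ≈⟨ ≈-sym (+-assoc w y (x + z)) ⟩
      (w + y) + (x + z) ∎

  sumL-++ : {A : Set} (F : A → Carrier) → ∀ l l′ → sumL F (l ++ l′) ≈ sumL F l + sumL F l′
  sumL-++ F []      l′ = ≈-sym (+-identityˡ _)
  sumL-++ F (a ∷ l) l′ = ≈-trans (+-congˡ (sumL-++ F l l′)) (≈-sym (+-assoc _ _ _))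

  sumL-map : {A B : Set} (F : B → Carrier) (h : A → B) → ∀ l → sumL F (map h l) ≡ sumL (F ∘ h) l
  sumL-map F h []      = refl
  sumL-map F h (a ∷ l) = cong (λ t → F (h a) + t) (sumL-map F h l)

  sumL-concatMap : {A B : Set} (F : B → Carrier) (f : A → List B) → ∀ l →
    sumL F (concatMap f l) ≈ sumL (λ a → sumL F (f a)) l
  sumL-concatMap F f []      = ≈-refl
  sumL-concatMap F f (a ∷ l) = ≈-trans (sumL-++ F (f a) (concatMap f l)) (+-congˡ (sumL-concatMap F f l))

  sumL-range : (K : ℤ → Carrier) → ∀ N →
    sumL K (range N) ≈ (K (+ 0) + sumL (K ∘ +_ ∘ suc) (upTo N)) + sumL (K ∘ -[1+_]) (upTo N)
  sumL-range K N = ≈-trans (sumL-++ K (map +_ (upTo (suc N))) (map -[1+_] (upTo N)))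
                           (+-cong (+-congˡ positives) (reflexive (sumL-map K -[1+_] (upTo N))))
    where
    positives : sumL K (map +_ (applyUpTo suc N)) ≈ sumL (K ∘ +_ ∘ suc) (upTo N)
    positives = begin
      sumL K (map +_ (applyUpTo suc N))  ≡⟨ sumL-map K +_ (applyUpTo suc N) ⟩
      sumL (K ∘ +_) (applyUpTo suc N)    ≡⟨ cong (sumL (K ∘ +_)) (sym (ListP.map-upTo suc N)) ⟩
      sumL (K ∘ +_) (map suc (upTo N))   ≡⟨ sumL-map (K ∘ +_) suc (upTo N) ⟩
      sumL (K ∘ +_ ∘ suc) (upTo N)       ∎

  sumL-range-neg : (H : ℤ → Carrier) → ∀ N → sumL (H ∘ -_) (range N) ≈ sumL H (range N)
  sumL-range-neg H N = begin
    sumL (H ∘ -_) (range N)          ≈⟨ sumL-range (H ∘ -_) N ⟩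
    (H (+ 0) + negative) + positive  ≈⟨ +-assoc _ negative positive ⟩
    H (+ 0) + (negative + positive)  ≈⟨ +-congˡ (+-comm negative positive) ⟩
    H (+ 0) + (positive + negative)  ≈⟨ ≈-sym (+-assoc _ positive negative) ⟩
    (H (+ 0) + positive) + negative  ≈⟨ ≈-sym (sumL-range H N) ⟩
    sumL H (range N)                 ∎
    where
    positive = sumL (H ∘ +_ ∘ suc) (upTo N)
    negative = sumL (H ∘ -[1+_]) (upTo N)

  sumL-negFirst : ∀ n (F : Vec ℤ (suc n) → Carrier) →
    sumL (F ∘ negFirst) (candidates (suc n)) ≈ sumL F (candidates (suc n))
  sumL-negFirst n F = begin
    sumL (F ∘ negFirst) (concatMap (λ x → map (x ∷_) V) Rg) ≈⟨ sumL-concatMap (F ∘ negFirst) (λ x → map (x ∷_) V) Rg ⟩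
    sumL (λ x → sumL (F ∘ negFirst) (map (x ∷_) V)) Rg      ≈⟨ sumL-cong (λ x → reflexive (sumL-map _ (x ∷_) V)) Rg ⟩
    sumL (H ∘ -_) Rg                                         ≈⟨ sumL-range-neg H (suc n) ⟩
    sumL H Rg                                                ≈⟨ sumL-cong (λ x → reflexive (sym (sumL-map F (x ∷_) V))) Rg ⟩
    sumL (λ x → sumL F (map (x ∷_) V)) Rg                    ≈⟨ ≈-sym (sumL-concatMap F (λ x → map (x ∷_) V) Rg) ⟩
    sumL F (concatMap (λ x → map (x ∷_) V) Rg)              ∎
    where
    Rg = range (suc n)
    V  = vecsOver Rg n
    H  = λ y → sumL (λ v → F (y ∷ v)) V

  indicator : ∀ {n} → (Vec ℤ n → Bool) → Vec ℤ n → Carrier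
  indicator P β = if P β then pow R q (ℓD β) else 0#

  genFun≈sumL : ∀ n (P : Vec ℤ n → Bool) → genFun R n P q ≈ sumL (indicator P) (candidates n)
  genFun≈sumL n P = go (candidates n)
    where
    go : ∀ L → Data.List.foldr (λ β acc → pow R q (ℓD β) + acc) 0# (filter (λ β → P β Data.Bool.≟ true) L)
               ≈ sumL (indicator P) L
    go []      = ≈-refl
    go (β ∷ L) with P β
    ... | true  = +-congˡ (go L)
    ... | false = ≈-trans (go L) (≈-sym (+-identityˡ _))

  split-by : ∀ e W → W ≈ (if e then W else 0#) + (if not e then W else 0#)
  split-by true  W = ≈-sym (+-identityʳ W)
  split-by false W = ≈-sym (+-identityˡ W)

  -- Pointwise form of (ii): 1_{B(M)} = 1_{D(M)} + 1_{D(M)} ∘ negFirst, with weights q^{ℓ_D}.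
  indicator-split : ∀ {n} M (β : Vec ℤ (suc n)) → 0 ∈ M →
    indicator (inBM M) β ≈ indicator (inDM M) β + indicator (inDM M) (negFirst β)
  indicator-split M β 0∈M rewrite inDM≡ M β 0∈M | ℓD-negFirst β with inBM M β in β∈B
  ... | true  rewrite inDM-negFirst M β 0∈M (subst T (sym β∈B) tt) = split-by (isEvenSigned β) _
  ... | false rewrite inDM≡ M (negFirst β) 0∈M | inBM-negFirst M β 0∈M | β∈B = ≈-sym (+-identityˡ 0#)

  genFun-B≈2D : ∀ n M → 0 ∈ M →
    genFun R (suc n) (inBM M) q ≈ genFun R (suc n) (inDM M) q + genFun R (suc n) (inDM M) q
  genFun-B≈2D n M 0∈M = begin
    genFun R (suc n) (inBM M) q                ≈⟨ genFun≈sumL (suc n) (inBM M) ⟩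
    sumL (indicator (inBM M)) C                ≈⟨ sumL-cong (λ β → indicator-split M β 0∈M) C ⟩
    sumL (λ β → 1D β + 1D (negFirst β)) C      ≈⟨ sumL-+ 1D (1D ∘ negFirst) C ⟩
    sumL 1D C + sumL (1D ∘ negFirst) C         ≈⟨ +-congˡ (sumL-negFirst n 1D) ⟩
    sumL 1D C + sumL 1D C                      ≈⟨ ≈-sym (+-cong (genFun≈sumL (suc n) (inDM M)) (genFun≈sumL (suc n) (inDM M))) ⟩
    genFun R (suc n) (inDM M) q + genFun R (suc n) (inDM M) q ∎
    where
    C  = candidates (suc n)
    1D = indicator (inDM M)

-- Proposition 3.4.
proposition3p4 : {c ℓ : Level} → (n : ℕ) → 2 ≤ n → (M : List ℕ) → AllPairs _<_ M → All (_< n) M → 0 ∈ M →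
    (((β : Vec ℤ n) → T (inBM M β) ⇔ (T (inDM M β) ⊎ InDbar M β))
      × ((β : Vec ℤ n) → T (inDM M β) → InDbar M β → ⊥)
      × ((γ : Vec ℤ n) → T (inDM M γ) → negFirst γ ≡ compose γ (s0B n)))
    × ((R : CommutativeSemiring c ℓ) (q : CommutativeSemiring.Carrier R) →
        CommutativeSemiring._≈_ R (genFun R n (inBM M) q)
          (CommutativeSemiring._+_ R (genFun R n (inDM M) q) (genFun R n (inDM M) q)))
proposition3p4 (suc n) _ M _ _ 0∈M =
  ( (λ β → B⇔D⊎D̄ M β 0∈M)
  , D∩D̄-empty M
  , (λ γ _ → negFirst≡compose-s0B γ) )
  , (λ R q → WeightedSums.genFun-B≈2D R q n M 0∈M)
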